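{- There is a function $\varepsilon:\mathbb{N}\to\mathbb{R}$ with $\varepsilon(n)\to0$ as $n\to\infty$ such that for every $n$ there is a monotone 2-CNF formula with $n$ variables whose smallest 2-CNF encoding has at least $\left(\frac14-\varepsilon(n)\right)\frac{n^2}{\lg n}$ clauses.
   Context: Literals, clauses (sets of non-complementary literals), formulas (sets of clauses); 2-CNF means every clause has exactly two literals; monotone means all literals are positive; $\lg$ is base-2 logarithm. Given a Boolean function $f$ on base variables $X=(x_1,\dots,x_n)$, a CNF formula $\psi$ over $X\sqcup Y$ (with arbitrary auxiliary variables $Y$) encodes $f$ if for every assignment $\tau$ of $X$, $f(\tau)=\top$ iff $\psi|_\tau$ is satisfiable. A 2-CNF encoding of a formula $\varphi$ is a 2-CNF formula encoding the Boolean function defined by $\varphi$ with base variables $\textsf{Var}(\varphi)$; the smallest one is one with the fewest clauses. -}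

module Defs where

open import Data.Nat using (ℕ; _+_; _*_; _^_; _≤_; _∸_)
open import Data.Bool using (Bool; true; false; _∨_; not; T)
open import Data.Fin using (Fin)
open import Data.Sum using (_⊎_; inj₁; inj₂; [_,_])
open import Data.Product using (Σ; _×_; _,_; proj₁; proj₂; ∃-syntax)
open import Data.List using (List; length)
open import Data.List.Relation.Unary.All using (All)
open import Data.List.Relation.Unary.Any using (Any)
open import Relation.Binary.PropositionalEquality using (_≡_; _≢_)
open import Function using (_⇔_)

-- A literal: a variable with a polarity (true = positive, false = negated).
record Lit (V : Set) : Set where
  constructor lit
  field
    pol : Bool
    var : V
open Lit public

-- A 2-clause: exactly two literals, which are distinct and
-- non-complementary, i.e. their variables are distinct.
record Clause2 (V : Set) : Set where
  constructor clause
  field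
    l₁ l₂    : Lit V
    distinct : var l₁ ≢ var l₂
open Clause2 public

-- Its number of
-- clauses is 'length'.  (Duplicates are harmless for lower bounds on
-- the minimum size: removing duplicates gives a set of clauses with the
-- same semantics and no more clauses.)
TwoCNF : Set → Set
TwoCNF V = List (Clause2 V)

evalLit : {V : Set} → (V → Bool) → Lit V → Bool
evalLit σ (lit true  v) = σ v
evalLit σ (lit false v) = not (σ v)

SatClause : {V : Set} → (V → Bool) → Clause2 V → Set
SatClause σ c = T (evalLit σ (l₁ c) ∨ evalLit σ (l₂ c))

SatCNF : {V : Set} → (V → Bool) → TwoCNF V → Set
SatCNF σ ψ = All (SatClause σ) ψ

-- Monotone 2-CNF over base variables Fin n: clauses are pairs of two
-- distinct positive literals.

MonClause : ℕ → Set
MonClause n = Σ (Fin n × Fin n) (λ p → proj₁ p ≢ proj₂ p)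

Monotone2CNF : ℕ → Set
Monotone2CNF n = List (MonClause n)

evalMon : {n : ℕ} → (Fin n → Bool) → Monotone2CNF n → Set
evalMon τ φ = All (λ c → T (τ (proj₁ (proj₁ c)) ∨ τ (proj₂ (proj₁ c)))) φ

Occurs : {n : ℕ} → Fin n → Monotone2CNF n → Set
Occurs i φ = Any (λ c → (proj₁ (proj₁ c) ≡ i) ⊎ (proj₂ (proj₁ c) ≡ i)) φ

HasAllVars : {n : ℕ} → Monotone2CNF n → Set
HasAllVars {n} φ = (i : Fin n) → Occurs i φ

-- Encodings: a 2-CNF ψ over X ⊔ Y (X = Fin n base, Y = Fin m auxiliary)
-- encodes φ if for every assignment τ of X:  φ(τ) ⇔ ψ|τ satisfiable,
-- where ψ|τ satisfiable means some σ : Y → Bool makes ψ true under (τ,σ).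

Encodes : {n : ℕ} (m : ℕ) → TwoCNF (Fin n ⊎ Fin m) → Monotone2CNF n → Set
Encodes {n} m ψ φ =
  (τ : Fin n → Bool) →
  evalMon τ φ ⇔ (∃[ σ ] SatCNF [ τ , σ ] ψ)

SmallestEncodingAtLeast : {n : ℕ} → Monotone2CNF n → (ℕ → Set) → Set
SmallestEncodingAtLeast {n} φ Big =
  (m : ℕ) (ψ : TwoCNF (Fin n ⊎ Fin m)) → Encodes m ψ φ → Big (length ψ)

-- For δ = 1/k, the real inequality  c ≥ (1/4 − 1/k) · n² / lg n  (n ≥ 2)
-- is equivalent to  4k·c·lg n ≥ (k−4)·n²,  i.e. to
--   2^((k−4)·n²) ≤ n^(4·k·c)     (with truncated subtraction; for k ≤ 4
-- the bound is vacuous, matching a non-positive lower bound).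
BoundHolds : (k n c : ℕ) → Set
BoundHolds k n c = 2 ^ ((k ∸ 4) * (n * n)) ≤ n ^ (4 * k * c)

{-# OPTIONS --safe #-}
-- Let φ_b consist of the spokes {0, i} for 1 ≤ i ≤ s and the edges of a graph b on
-- the vertices 1, …, s.  The assignment that is false exactly at the two ends of a
-- pair p falsifies φ_b iff p is an edge of b, so the Boolean function of φ_b
-- determines b, and there are 2 ^ (s choose 2) of these functions.  An encoding
-- with c ≤ K clauses mentions at most 2c < 2K + 1 auxiliary variables; renaming
-- them by their first occurrence turns it into a set of at most K among
-- U = (2 (n + 2K + 1))² clause codes, and this set determines the encoded function.
-- For K ≈ (1/4 − 1/k) n² / lg n there are at most (U + K) ^ K / K! < 2 ^ (s choose 2)
-- such sets, so some b has no encoding with at most K clauses.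
module Submission where

open import Defs
open import Level using (0ℓ)
open import Data.Nat hiding (_≟_)
open import Data.Nat.Properties hiding (_≟_; suc-injective)
open import Data.Nat.DivMod using (m≡m%n+[m/n]*n; m%n<n; m/n*n≤m)
open import Data.Nat.Tactic.RingSolver using (solve-∀)
open import Data.Bool using (Bool; true; false; T; not; _∨_)
open import Data.Bool.Properties using (∨-zeroʳ; T-≡; not-involutive)
open import Data.Unit using (tt)
open import Data.Empty using (⊥-elim)
open import Data.Product as Product using (_×_; _,_; proj₁; proj₂; ∃-syntax)
open import Data.Sum as Sum using (_⊎_; inj₁; inj₂; [_,_])
open import Data.Sum.Properties using (≡-dec)
open import Data.Fin
  using (Fin; zero; suc; toℕ; fromℕ; fromℕ<; inject₁; splitAt; join; _↑ˡ_; _↑ʳ_; combine; remQuot; _≟_)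
open import Data.Fin.Properties
  using (toℕ-fromℕ; toℕ-fromℕ<; inject₁ℕ<; toℕ-inject₁; fromℕ≢inject₁; inject₁-injective; suc-injective;
         splitAt-↑ˡ; splitAt-↑ʳ; splitAt⁻¹-↑ˡ; splitAt⁻¹-↑ʳ; splitAt-join; remQuot-combine; all?)
open import Data.Fin.Subset using (Subset; ∣_∣; inside; outside; ⊥; ⁅_⁆; _∪_) renaming (_∈_ to _∈ₛ_)
open import Data.Fin.Subset.Properties
  using (∣⊥∣≡0; ∣p∣≤∣x∷p∣; ∣⁅x⁆∣≡1; x∈⁅x⁆; x∈⁅y⁆⇒x≡y; x∈p∪q⁺; x∈p∪q⁻; ∉⊥; anySubset?)
  renaming (_∈?_ to _∈ₛ?_)
open import Data.Vec using (Vec; []; _∷_; lookup; tabulate; replicate)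
open import Data.Vec.Properties using (lookup∘tabulate; tabulate-cong; tabulate∘lookup)
open import Data.List using (List; []; _∷_; length; map; _++_; foldr; filter; allFin)
open import Data.List.Properties using (length-map; length-++)
open import Data.List.Membership.Propositional using (_∈_; _∉_; lose)
open import Data.List.Membership.Propositional.Properties
  using (∈-map⁺; ∈-map⁻; ∈-++⁺ˡ; ∈-++⁺ʳ; ∈-filter⁺; ∈-filter⁻; ∈-allFin)
open import Data.List.Relation.Unary.All as All using (All)
open import Data.List.Relation.Unary.All.Properties using (++⁺; ++⁻ʳ; map⁺)
open import Data.List.Relation.Unary.Any using (here; there)
open import Function using (_∘_; _⇔_; mk⇔; Equivalence)
open import Function.Properties.Equivalence using (⇔-setoid)
open import Relation.Binary using (DecidableEquality)
open import Relation.Nullary using (¬_; Dec; does; proof; yes; no; contradiction)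
open import Relation.Nullary.Decidable using (T?; dec-true; _→-dec_)
open import Relation.Nullary.Reflects using (fromEquivalence; det)
open import Relation.Binary.PropositionalEquality hiding ([_])

tailsWithHead : ∀ {P} → Bool → List (Vec Bool (suc P)) → List (Vec Bool P)
tailsWithHead b [] = []
tailsWithHead false ((false ∷ v) ∷ vs) = v ∷ tailsWithHead false vs
tailsWithHead false ((true  ∷ v) ∷ vs) = tailsWithHead false vs
tailsWithHead true  ((false ∷ v) ∷ vs) = tailsWithHead true vs
tailsWithHead true  ((true  ∷ v) ∷ vs) = v ∷ tailsWithHead true vs

∈-tailsWithHead : ∀ {P} b {v : Vec Bool P} {vs} → b ∷ v ∈ vs → v ∈ tailsWithHead b vs
∈-tailsWithHead false {vs = (false ∷ _) ∷ _} (here refl) = here refl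
∈-tailsWithHead true  {vs = (true  ∷ _) ∷ _} (here refl) = here refl
∈-tailsWithHead false {vs = (false ∷ _) ∷ _} (there v∈vs) = there (∈-tailsWithHead false v∈vs)
∈-tailsWithHead false {vs = (true  ∷ _) ∷ _} (there v∈vs) = ∈-tailsWithHead false v∈vs
∈-tailsWithHead true  {vs = (false ∷ _) ∷ _} (there v∈vs) = ∈-tailsWithHead true v∈vs
∈-tailsWithHead true  {vs = (true  ∷ _) ∷ _} (there v∈vs) = there (∈-tailsWithHead true v∈vs)

length-tailsWithHead : ∀ {P} (vs : List (Vec Bool (suc P))) →
  length (tailsWithHead true vs) + length (tailsWithHead false vs) ≡ length vs
length-tailsWithHead [] = refl
length-tailsWithHead ((true ∷ v) ∷ vs) = cong suc (length-tailsWithHead vs)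
length-tailsWithHead ((false ∷ v) ∷ vs) =
  trans (+-suc _ _) (cong suc (length-tailsWithHead vs))

bitVector-pigeonhole : ∀ P (vs : List (Vec Bool P)) → length vs < 2 ^ P → ∃[ b ] b ∉ vs
bitVector-pigeonhole zero [] _ = [] , λ ()
bitVector-pigeonhole zero (_ ∷ _) (s≤s ())
bitVector-pigeonhole (suc P) vs vs<2^[1+P]
  with length (tailsWithHead true vs) <? 2 ^ P
... | yes short = let v , v∉ = bitVector-pigeonhole P _ short in
  true ∷ v , v∉ ∘ ∈-tailsWithHead true
... | no long = let v , v∉ = bitVector-pigeonhole P _ short in
  false ∷ v , v∉ ∘ ∈-tailsWithHead false
  where
  short : length (tailsWithHead false vs) < 2 ^ P
  short = +-cancelˡ-< (2 ^ P) _ _ (begin-strict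
    2 ^ P + length (tailsWithHead false vs)
      ≤⟨ +-monoˡ-≤ _ (≮⇒≥ long) ⟩
    length (tailsWithHead true vs) + length (tailsWithHead false vs)
      ≡⟨ length-tailsWithHead vs ⟩
    length vs
      <⟨ vs<2^[1+P] ⟩
    2 ^ P + (2 ^ P + 0)
      ≡⟨ cong (2 ^ P +_) (+-identityʳ _) ⟩
    2 ^ P + 2 ^ P ∎)
    where open ≤-Reasoning

n!≤n^n : ∀ n → n ! ≤ n ^ n
n!≤n^n zero = ≤-refl
n!≤n^n (suc n) = *-monoʳ-≤ (suc n) (≤-trans (n!≤n^n n) (^-monoˡ-≤ n (n≤1+n n)))

m^[n∸m]≤n! : ∀ m n → m ^ (n ∸ m) ≤ n !
m^[n∸m]≤n! m zero = ≤-reflexive (cong (m ^_) (0∸n≡0 m))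
m^[n∸m]≤n! m (suc n) with m ≤? n
... | yes m≤n = begin
  m ^ (suc n ∸ m)   ≡⟨ cong (m ^_) (+-∸-assoc 1 m≤n) ⟩
  m * m ^ (n ∸ m)   ≤⟨ *-mono-≤ (m≤n⇒m≤1+n m≤n) (m^[n∸m]≤n! m n) ⟩
  suc n * n !       ∎
  where open ≤-Reasoning
... | no m≰n = begin
  m ^ (suc n ∸ m)   ≡⟨ cong (m ^_) (m≤n⇒m∸n≡0 (≰⇒> m≰n)) ⟩
  1                 ≤⟨ 1≤n! (suc n) ⟩
  suc n !           ∎
  where open ≤-Reasoning

x^[1+k]+[1+k]*x^k≤[1+x]^[1+k] : ∀ x k → x ^ suc k + suc k * x ^ k ≤ suc x ^ suc k
x^[1+k]+[1+k]*x^k≤[1+x]^[1+k] x zero = ≤-reflexive (+-comm (x * 1) 1)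
x^[1+k]+[1+k]*x^k≤[1+x]^[1+k] x (suc k) = begin
  x * x ^ suc k + suc (suc k) * x ^ suc k
    ≤⟨ m≤m+n _ (suc k * x ^ k) ⟩
  x * (x * x ^ k) + suc (suc k) * (x * x ^ k) + suc k * x ^ k
    ≡⟨ regroup x (x ^ k) k ⟩
  suc x * (x ^ suc k + suc k * x ^ k)
    ≤⟨ *-monoʳ-≤ (suc x) (x^[1+k]+[1+k]*x^k≤[1+x]^[1+k] x k) ⟩
  suc x ^ suc (suc k) ∎
  where
  open ≤-Reasoning
  regroup : ∀ x y k → x * (x * y) + suc (suc k) * (x * y) + suc k * y ≡ suc x * (x * y + suc k * y)
  regroup = solve-∀

subsetsOfSize≤ : (U K : ℕ) → List (Subset U)
subsetsOfSize≤ zero K = [] ∷ []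
subsetsOfSize≤ (suc U) zero = map (outside ∷_) (subsetsOfSize≤ U zero)
subsetsOfSize≤ (suc U) (suc K) =
  map (outside ∷_) (subsetsOfSize≤ U (suc K)) ++ map (inside ∷_) (subsetsOfSize≤ U K)

∈-subsetsOfSize≤ : ∀ {U} K (p : Subset U) → ∣ p ∣ ≤ K → p ∈ subsetsOfSize≤ U K
∈-subsetsOfSize≤ K [] _ = here refl
∈-subsetsOfSize≤ zero (outside ∷ p) ∣p∣≤0 =
  ∈-map⁺ (outside ∷_) (∈-subsetsOfSize≤ zero p ∣p∣≤0)
∈-subsetsOfSize≤ (suc K) (outside ∷ p) ∣p∣≤K =
  ∈-++⁺ˡ (∈-map⁺ (outside ∷_) (∈-subsetsOfSize≤ (suc K) p ∣p∣≤K))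
∈-subsetsOfSize≤ (suc K) (inside ∷ p) (s≤s ∣p∣≤K) =
  ∈-++⁺ʳ _ (∈-map⁺ (inside ∷_) (∈-subsetsOfSize≤ K p ∣p∣≤K))

length-subsetsOfSize≤-bound : ∀ U K → length (subsetsOfSize≤ U K) * K ! ≤ (U + K) ^ K
length-subsetsOfSize≤-bound zero K = ≤-trans (≤-reflexive (+-identityʳ (K !))) (n!≤n^n K)
length-subsetsOfSize≤-bound (suc U) zero = begin
  length (map (outside ∷_) (subsetsOfSize≤ U zero)) * 1
    ≡⟨ cong (_* 1) (length-map _ (subsetsOfSize≤ U zero)) ⟩
  length (subsetsOfSize≤ U zero) * 1
    ≤⟨ length-subsetsOfSize≤-bound U zero ⟩
  1 ∎
  where open ≤-Reasoning
length-subsetsOfSize≤-bound (suc U) (suc K) = begin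
  length (map (outside ∷_) without ++ map (inside ∷_) with′) * (suc K * K !)
    ≡⟨ cong (_* (suc K * K !)) (trans (length-++ (map (outside ∷_) without))
            (cong₂ _+_ (length-map _ without) (length-map _ with′))) ⟩
  (length without + length with′) * (suc K * K !)
    ≡⟨ distribute (length without) (length with′) (K !) K ⟩
  length without * (suc K * K !) + suc K * (length with′ * K !)
    ≤⟨ +-mono-≤ (length-subsetsOfSize≤-bound U (suc K))
                (*-monoʳ-≤ (suc K) (≤-trans (length-subsetsOfSize≤-bound U K)
                                            (^-monoˡ-≤ K (+-monoʳ-≤ U (n≤1+n K))))) ⟩
  (U + suc K) ^ suc K + suc K * (U + suc K) ^ K
    ≤⟨ x^[1+k]+[1+k]*x^k≤[1+x]^[1+k] (U + suc K) K ⟩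
  suc (U + suc K) ^ suc K ∎
  where
  open ≤-Reasoning
  without = subsetsOfSize≤ U (suc K)
  with′ = subsetsOfSize≤ U K
  distribute : ∀ a b f k → (a + b) * (suc k * f) ≡ a * (suc k * f) + suc k * (b * f)
  distribute = solve-∀

∣p∪q∣≤∣p∣+∣q∣ : ∀ {n} (p q : Subset n) → ∣ p ∪ q ∣ ≤ ∣ p ∣ + ∣ q ∣
∣p∪q∣≤∣p∣+∣q∣ [] [] = z≤n
∣p∪q∣≤∣p∣+∣q∣ (inside ∷ p) (s ∷ q) =
  s≤s (≤-trans (∣p∪q∣≤∣p∣+∣q∣ p q) (+-monoʳ-≤ ∣ p ∣ (∣p∣≤∣x∷p∣ s q)))
∣p∪q∣≤∣p∣+∣q∣ (outside ∷ p) (inside ∷ q) =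
  ≤-trans (s≤s (∣p∪q∣≤∣p∣+∣q∣ p q)) (≤-reflexive (sym (+-suc ∣ p ∣ ∣ q ∣)))
∣p∪q∣≤∣p∣+∣q∣ (outside ∷ p) (outside ∷ q) = ∣p∪q∣≤∣p∣+∣q∣ p q

fromList : ∀ {n} → List (Fin n) → Subset n
fromList = foldr (λ x p → ⁅ x ⁆ ∪ p) ⊥

∣fromList∣≤length : ∀ {n} (xs : List (Fin n)) → ∣ fromList xs ∣ ≤ length xs
∣fromList∣≤length {n} [] = ≤-reflexive (∣⊥∣≡0 n)
∣fromList∣≤length (x ∷ xs) = begin
  ∣ ⁅ x ⁆ ∪ fromList xs ∣         ≤⟨ ∣p∪q∣≤∣p∣+∣q∣ ⁅ x ⁆ (fromList xs) ⟩
  ∣ ⁅ x ⁆ ∣ + ∣ fromList xs ∣     ≤⟨ +-mono-≤ (≤-reflexive (∣⁅x⁆∣≡1 x)) (∣fromList∣≤length xs) ⟩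
  suc (length xs)                 ∎
  where open ≤-Reasoning

∈-fromList⁺ : ∀ {n} {x : Fin n} {xs} → x ∈ xs → x ∈ₛ fromList xs
∈-fromList⁺ (here refl) = x∈p∪q⁺ (inj₁ (x∈⁅x⁆ _))
∈-fromList⁺ (there x∈xs) = x∈p∪q⁺ (inj₂ (∈-fromList⁺ x∈xs))

∈-fromList⁻ : ∀ {n} {x : Fin n} xs → x ∈ₛ fromList xs → x ∈ xs
∈-fromList⁻ [] x∈⊥ = ⊥-elim (∉⊥ x∈⊥)
∈-fromList⁻ (y ∷ ys) x∈ with x∈p∪q⁻ ⁅ y ⁆ (fromList ys) x∈
... | inj₁ x∈⁅y⁆ = here (x∈⁅y⁆⇒x≡y y x∈⁅y⁆)
... | inj₂ x∈ys = there (∈-fromList⁻ ys x∈ys)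

pairs : ℕ → ℕ
pairs zero = 0
pairs (suc s) = s + pairs s

2*pairs+s≡s*s : ∀ s → 2 * pairs s + s ≡ s * s
2*pairs+s≡s*s zero = refl
2*pairs+s≡s*s (suc s) = begin
  2 * (s + pairs s) + suc s        ≡⟨ regroup s (pairs s) ⟩
  (2 * pairs s + s) + (2 * s + 1)  ≡⟨ cong (_+ (2 * s + 1)) (2*pairs+s≡s*s s) ⟩
  s * s + (2 * s + 1)              ≡⟨ square-suc s ⟩
  suc s * suc s                    ∎
  where
  open ≡-Reasoning
  regroup : ∀ s t → 2 * (s + t) + suc s ≡ (2 * t + s) + (2 * s + 1)
  regroup = solve-∀
  square-suc : ∀ s → s * s + (2 * s + 1) ≡ suc s * suc s
  square-suc = solve-∀

pair : ∀ s → Fin (pairs s) → Fin s × Fin s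
pair (suc s) p with splitAt s p
... | inj₁ j = fromℕ s , inject₁ j
... | inj₂ q = Product.map inject₁ inject₁ (pair s q)

pair-ordered : ∀ s (p : Fin (pairs s)) → toℕ (proj₂ (pair s p)) < toℕ (proj₁ (pair s p))
pair-ordered (suc s) p with splitAt s p
... | inj₁ j = subst (toℕ (inject₁ j) <_) (sym (toℕ-fromℕ s)) (inject₁ℕ< j)
... | inj₂ q = subst₂ _<_ (sym (toℕ-inject₁ _)) (sym (toℕ-inject₁ _)) (pair-ordered s q)

pair-injective : ∀ s {p q : Fin (pairs s)} → pair s p ≡ pair s q → p ≡ q
pair-injective (suc s) {p} {q} eq with splitAt s p in ep | splitAt s q in eq′
... | inj₁ i | inj₁ j = begin
  p              ≡⟨ splitAt⁻¹-↑ˡ ep ⟨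
  i ↑ˡ pairs s   ≡⟨ cong (_↑ˡ pairs s) (inject₁-injective (cong proj₂ eq)) ⟩
  j ↑ˡ pairs s   ≡⟨ splitAt⁻¹-↑ˡ eq′ ⟩
  q              ∎
  where open ≡-Reasoning
... | inj₁ _ | inj₂ _ = ⊥-elim (fromℕ≢inject₁ (cong proj₁ eq))
... | inj₂ _ | inj₁ _ = ⊥-elim (fromℕ≢inject₁ (sym (cong proj₁ eq)))
... | inj₂ p′ | inj₂ q′ = begin
  p        ≡⟨ splitAt⁻¹-↑ʳ ep ⟨
  s ↑ʳ p′  ≡⟨ cong (s ↑ʳ_) (pair-injective s (cong₂ _,_ (inject₁-injective (cong proj₁ eq))
                                                      (inject₁-injective (cong proj₂ eq)))) ⟩
  s ↑ʳ q′  ≡⟨ splitAt⁻¹-↑ʳ eq′ ⟩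
  q        ∎
  where open ≡-Reasoning

spoke : ∀ {s} → Fin s → MonClause (suc s)
spoke i = (zero , suc i) , λ ()

edge : ∀ s → Fin (pairs s) → MonClause (suc s)
edge s p = (suc (proj₁ (pair s p)) , suc (proj₂ (pair s p))) ,
  λ eq → <-irrefl (cong toℕ (sym (suc-injective eq))) (pair-ordered s p)

-- The spokes make every variable occur and hold whenever vertex 0 is true.
graphFormula : ∀ s → Vec Bool (pairs s) → Monotone2CNF (suc s)
graphFormula s b =
  map spoke (allFin s) ++ map (edge s) (filter (T? ∘ lookup b) (allFin (pairs s)))

graphFormula-hasAllVars : ∀ s b → 0 < s → HasAllVars (graphFormula s b)
graphFormula-hasAllVars (suc s) b _ zero = lose (∈-++⁺ˡ (∈-map⁺ spoke (∈-allFin zero))) (inj₁ refl)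
graphFormula-hasAllVars s       b _ (suc i) = lose (∈-++⁺ˡ (∈-map⁺ spoke (∈-allFin i))) (inj₂ refl)

trueOutside : ∀ {s} → Fin s × Fin s → Fin (suc s) → Bool
trueOutside _ zero = true
trueOutside (i , j) (suc x) = not (does (x ≟ i) ∨ does (x ≟ j))

SatMonClause : ∀ {n} → (Fin n → Bool) → MonClause n → Set
SatMonClause τ c = T (τ (proj₁ (proj₁ c)) ∨ τ (proj₂ (proj₁ c)))

edge-falsified : ∀ s p → ¬ SatMonClause (trueOutside (pair s p)) (edge s p)
edge-falsified s p with pair s p
... | i , j rewrite dec-true (i ≟ i) refl | dec-true (j ≟ j) refl | ∨-zeroʳ (does (j ≟ i)) = λ ()

trueOutside-distinct : ∀ {s} {a c i j : Fin s} →
  toℕ c < toℕ a → toℕ j < toℕ i → (a , c) ≢ (i , j) →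
  T (trueOutside (i , j) (suc a) ∨ trueOutside (i , j) (suc c))
trueOutside-distinct {a = a} {c} {i} {j} c<a j<i ac≢ij with a ≟ i | a ≟ j | c ≟ i | c ≟ j
... | no _     | no _     | _        | _        = tt
... | yes _    | _        | no _     | no _     = tt
... | no _     | yes _    | no _     | no _     = tt
... | yes refl | _        | _        | yes refl = ⊥-elim (ac≢ij refl)
... | yes refl | _        | yes refl | _        = ⊥-elim (<-irrefl refl c<a)
... | _        | yes refl | _        | yes refl = ⊥-elim (<-irrefl refl c<a)
... | _        | yes refl | yes refl | _        = ⊥-elim (<-asym c<a j<i)

edge-satisfied : ∀ s {p q} → q ≢ p → SatMonClause (trueOutside (pair s p)) (edge s q)
edge-satisfied s {p} {q} q≢p =
  trueOutside-distinct (pair-ordered s q) (pair-ordered s p) (q≢p ∘ pair-injective s)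

graphFormula-trueOutside : ∀ s b p →
  evalMon (trueOutside (pair s p)) (graphFormula s b) ⇔ T (not (lookup b p))
graphFormula-trueOutside s b p = mk⇔ to from
  where
  to : evalMon (trueOutside (pair s p)) (graphFormula s b) → T (not (lookup b p))
  to sat with lookup b p in bp
  ... | false = tt
  ... | true = edge-falsified s p (All.lookup (++⁻ʳ (map spoke (allFin s)) sat)
                 (∈-map⁺ (edge s) (∈-filter⁺ (T? ∘ lookup b) (∈-allFin p) (subst T (sym bp) tt))))
  from : T (not (lookup b p)) → evalMon (trueOutside (pair s p)) (graphFormula s b)
  from ¬bp = ++⁺ (map⁺ (All.universal (λ _ → tt) (allFin s)))
                 (map⁺ (All.tabulate (edge-satisfied s ∘ selected≢p ∘ selected)))
    where
    selected : ∀ {q} → q ∈ filter (T? ∘ lookup b) (allFin (pairs s)) → T (lookup b q)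
    selected = proj₂ ∘ ∈-filter⁻ (T? ∘ lookup b) {xs = allFin (pairs s)}
    selected≢p : ∀ {q} → T (lookup b q) → q ≢ p
    selected≢p bq refl = subst (T ∘ not) (Equivalence.to T-≡ bq) ¬bp

-- Renamed clauses are bare pairs of literals, so renaming needs no distinctness proof.
ClausePair : Set → Set
ClausePair V = Lit V × Lit V

evalPair : ∀ {V} → (V → Bool) → ClausePair V → Bool
evalPair ρ (l₁ , l₂) = evalLit ρ l₁ ∨ evalLit ρ l₂

module ClauseCodes (n M : ℕ) where

  private
    V = n + M

  #codes : ℕ
  #codes = (V + V) * (V + V)

  encodeLit : Lit (Fin n ⊎ Fin M) → Fin (V + V)
  encodeLit (lit false x) = join n M x ↑ˡ V
  encodeLit (lit true  x) = V ↑ʳ join n M x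

  decodeLit : Fin (V + V) → Lit (Fin n ⊎ Fin M)
  decodeLit = [ lit false ∘ splitAt n , lit true ∘ splitAt n ] ∘ splitAt V

  decodeLit-encodeLit : ∀ l → decodeLit (encodeLit l) ≡ l
  decodeLit-encodeLit (lit false x) rewrite splitAt-↑ˡ V (join n M x) V | splitAt-join n M x = refl
  decodeLit-encodeLit (lit true  x) rewrite splitAt-↑ʳ V V (join n M x) | splitAt-join n M x = refl

  encode : ClausePair (Fin n ⊎ Fin M) → Fin #codes
  encode (l₁ , l₂) = combine (encodeLit l₁) (encodeLit l₂)

  decode : Fin #codes → ClausePair (Fin n ⊎ Fin M)
  decode = Product.map decodeLit decodeLit ∘ remQuot (V + V)

  decode-encode : ∀ c → decode (encode c) ≡ c
  decode-encode (l₁ , l₂) =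
    trans (cong (Product.map decodeLit decodeLit) (remQuot-combine (encodeLit l₁) (encodeLit l₂)))
          (cong₂ _,_ (decodeLit-encodeLit l₁) (decodeLit-encodeLit l₂))

  SatCodes : (Fin n ⊎ Fin M → Bool) → Subset #codes → Set
  SatCodes ρ S = ∀ u → u ∈ₛ S → T (evalPair ρ (decode u))

  Satisfiable : (Fin n → Bool) → Subset #codes → Set
  Satisfiable τ S = ∃[ v ] SatCodes [ τ , lookup v ] S

  satisfiable? : ∀ τ S → Dec (Satisfiable τ S)
  satisfiable? τ S = anySubset? λ v → all? λ u → u ∈ₛ? S →-dec T? _

  satisfiable-fromList : ∀ τ (cs : List (ClausePair (Fin n ⊎ Fin M))) →
    Satisfiable τ (fromList (map encode cs)) ⇔ (∃[ v ] All (T ∘ evalPair [ τ , lookup v ]) cs)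
  satisfiable-fromList τ cs = mk⇔ (Product.map₂ to) (Product.map₂ from)
    where
    to : ∀ {ρ} → SatCodes ρ (fromList (map encode cs)) → All (T ∘ evalPair ρ) cs
    to {ρ} sat = All.tabulate λ {c} c∈cs →
      subst (T ∘ evalPair ρ) (decode-encode c) (sat (encode c) (∈-fromList⁺ (∈-map⁺ encode c∈cs)))
    from : ∀ {ρ} → All (T ∘ evalPair ρ) cs → SatCodes ρ (fromList (map encode cs))
    from {ρ} sat u u∈S with ∈-map⁻ encode (∈-fromList⁻ (map encode cs) u∈S)
    ... | c , c∈cs , refl = subst (T ∘ evalPair ρ) (sym (decode-encode c)) (All.lookup sat c∈cs)

module _ {A : Set} (_≟ᴬ_ : DecidableEquality A) where

  position : A → List A → ℕ
  position x [] = 0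
  position x (y ∷ ys) with x ≟ᴬ y
  ... | yes _ = 0
  ... | no _ = suc (position x ys)

  position≤length : ∀ x xs → position x xs ≤ length xs
  position≤length x [] = z≤n
  position≤length x (y ∷ ys) with x ≟ᴬ y
  ... | yes _ = z≤n
  ... | no _ = s≤s (position≤length x ys)

  -- f applied to the i-th entry of xs, and false past the end of xs.
  valueAt : (A → Bool) → List A → ℕ → Bool
  valueAt f [] _ = false
  valueAt f (x ∷ xs) zero = f x
  valueAt f (x ∷ xs) (suc i) = valueAt f xs i

  valueAt-position : ∀ f {x} xs → x ∈ xs → valueAt f xs (position x xs) ≡ f x
  valueAt-position f {x} (y ∷ ys) x∈ with x ≟ᴬ y
  ... | yes refl = refl
  valueAt-position f (y ∷ ys) (here refl)  | no x≢y = ⊥-elim (x≢y refl)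
  valueAt-position f (y ∷ ys) (there x∈ys) | no _   = valueAt-position f ys x∈ys

variables : ∀ {V} → TwoCNF V → List V
variables [] = []
variables (c ∷ ψ) = var (l₁ c) ∷ var (l₂ c) ∷ variables ψ

length-variables : ∀ {V} (ψ : TwoCNF V) → length (variables ψ) ≡ 2 * length ψ
length-variables [] = refl
length-variables (c ∷ ψ) =
  cong suc (trans (cong suc (length-variables ψ)) (sym (+-suc (length ψ) (length ψ + 0))))

∈-variables : ∀ {V} {c : Clause2 V} {ψ} → c ∈ ψ →
  var (l₁ c) ∈ variables ψ × var (l₂ c) ∈ variables ψ
∈-variables (here refl) = here refl , there (here refl)
∈-variables {ψ = _ ∷ _} (there c∈ψ) = Product.map (there ∘ there) (there ∘ there) (∈-variables c∈ψ)

mapLit : ∀ {A B : Set} → (A → B) → Lit A → Lit B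
mapLit f (lit b x) = lit b (f x)

evalLit-mapLit : ∀ {A B : Set} (f : A → B) {ρ ρ′} l → ρ′ (f (var l)) ≡ ρ (var l) →
  evalLit ρ′ (mapLit f l) ≡ evalLit ρ l
evalLit-mapLit f (lit true  x) agree = agree
evalLit-mapLit f (lit false x) agree = cong not agree

renameClause : ∀ {A B : Set} → (A → B) → Clause2 A → ClausePair B
renameClause f c = mapLit f (l₁ c) , mapLit f (l₂ c)

evalPair-renameClause : ∀ {A B : Set} (f : A → B) {ρ ρ′} (c : Clause2 A) →
  ρ′ (f (var (l₁ c))) ≡ ρ (var (l₁ c)) → ρ′ (f (var (l₂ c))) ≡ ρ (var (l₂ c)) →
  evalPair ρ′ (renameClause f c) ≡ evalLit ρ (l₁ c) ∨ evalLit ρ (l₂ c)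
evalPair-renameClause f c agree₁ agree₂ =
  cong₂ _∨_ (evalLit-mapLit f (l₁ c) agree₁) (evalLit-mapLit f (l₂ c) agree₂)

module _ {n m : ℕ} (M : ℕ) (ψ : TwoCNF (Fin n ⊎ Fin m)) (2ψ<M : 2 * length ψ < M) where

  private
    _≟ⱽ_ : DecidableEquality (Fin n ⊎ Fin m)
    _≟ⱽ_ = ≡-dec _≟_ _≟_

    positionOf : Fin n ⊎ Fin m → ℕ
    positionOf x = position _≟ⱽ_ x (variables ψ)

    positionOf<M : ∀ x → positionOf x < M
    positionOf<M x = ≤-<-trans (≤-trans (position≤length _≟ⱽ_ x (variables ψ))
                                        (≤-reflexive (length-variables ψ))) 2ψ<M

  renameAux : Fin m → Fin M
  renameAux y = fromℕ< (positionOf<M (inj₂ y))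

  normalForm : List (ClausePair (Fin n ⊎ Fin M))
  normalForm = map (renameClause (Sum.map₂ renameAux)) ψ

  length-normalForm : length normalForm ≡ length ψ
  length-normalForm = length-map _ ψ

  normalForm-sat : ∀ τ →
    (∃[ σ ] SatCNF [ τ , σ ] ψ) ⇔ (∃[ v ] All (T ∘ evalPair [ τ , lookup v ]) normalForm)
  normalForm-sat τ = mk⇔ to from
    where
    to : ∃[ σ ] SatCNF [ τ , σ ] ψ → ∃[ v ] All (T ∘ evalPair [ τ , lookup v ]) normalForm
    to (σ , sat) = v , map⁺ (All.tabulate λ {c} c∈ψ →
        let x₁∈ , x₂∈ = ∈-variables c∈ψ in
        subst T (sym (evalPair-renameClause (Sum.map₂ renameAux) c (agree x₁∈) (agree x₂∈)))
              (All.lookup sat c∈ψ))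
      where
      valueOf : ℕ → Bool
      valueOf = valueAt _≟ⱽ_ [ τ , σ ] (variables ψ)
      v : Vec Bool M
      v = tabulate (valueOf ∘ toℕ)
      agree : ∀ {x} → x ∈ variables ψ → [ τ , lookup v ] (Sum.map₂ renameAux x) ≡ [ τ , σ ] x
      agree {inj₁ _} _ = refl
      agree {inj₂ y} y∈ = begin
        lookup v (renameAux y)          ≡⟨ lookup∘tabulate _ (renameAux y) ⟩
        valueOf (toℕ (renameAux y))     ≡⟨ cong valueOf (toℕ-fromℕ< (positionOf<M (inj₂ y))) ⟩
        valueOf (positionOf (inj₂ y))   ≡⟨ valueAt-position _≟ⱽ_ [ τ , σ ] (variables ψ) y∈ ⟩
        σ y                             ∎
        where open ≡-Reasoning
    from : ∃[ v ] All (T ∘ evalPair [ τ , lookup v ]) normalForm → ∃[ σ ] SatCNF [ τ , σ ] ψ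
    from (v , sat) = lookup v ∘ renameAux , All.tabulate λ {c} c∈ψ →
        subst T (evalPair-renameClause (Sum.map₂ renameAux) c (agree (var (l₁ c))) (agree (var (l₂ c))))
              (All.lookup sat (∈-map⁺ _ c∈ψ))
      where
      agree : ∀ x → [ τ , lookup v ] (Sum.map₂ renameAux x) ≡ [ τ , lookup v ∘ renameAux ] x
      agree (inj₁ _) = refl
      agree (inj₂ _) = refl

module _ (s K : ℕ) where

  open ClauseCodes (suc s) (suc (2 * K))

  private
    2c<M : ∀ {c} → c ≤ K → 2 * c < suc (2 * K)
    2c<M c≤K = s≤s (*-monoʳ-≤ 2 c≤K)

  encodingCode : ∀ {m} (ψ : TwoCNF (Fin (suc s) ⊎ Fin m)) → length ψ ≤ K → Subset #codes
  encodingCode ψ ψ≤K = fromList (map encode (normalForm _ ψ (2c<M ψ≤K)))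

  ∣encodingCode∣≤K : ∀ {m} (ψ : TwoCNF (Fin (suc s) ⊎ Fin m)) (ψ≤K : length ψ ≤ K) →
    ∣ encodingCode ψ ψ≤K ∣ ≤ K
  ∣encodingCode∣≤K ψ ψ≤K = begin
    ∣ encodingCode ψ ψ≤K ∣       ≤⟨ ∣fromList∣≤length (map encode cs) ⟩
    length (map encode cs)       ≡⟨ length-map encode cs ⟩
    length cs                    ≡⟨ length-normalForm _ ψ (2c<M ψ≤K) ⟩
    length ψ                     ≤⟨ ψ≤K ⟩
    K                            ∎
    where
    open ≤-Reasoning
    cs = normalForm _ ψ (2c<M ψ≤K)

  decodeGraph : Subset #codes → Vec Bool (pairs s)
  decodeGraph S = tabulate λ p → not (does (satisfiable? (trueOutside (pair s p)) S))

  decodeGraph-encodingCode : ∀ {m} b (ψ : TwoCNF (Fin (suc s) ⊎ Fin m)) (ψ≤K : length ψ ≤ K) →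
    Encodes m ψ (graphFormula s b) → decodeGraph (encodingCode ψ ψ≤K) ≡ b
  decodeGraph-encodingCode b ψ ψ≤K enc = trans (tabulate-cong bit) (tabulate∘lookup b)
    where
    S = encodingCode ψ ψ≤K
    satisfiable⇔ : ∀ p → Satisfiable (trueOutside (pair s p)) S ⇔ T (not (lookup b p))
    satisfiable⇔ p = begin
      Satisfiable τ S                 ≈⟨ satisfiable-fromList τ _ ⟩
      (∃[ v ] _)                      ≈⟨ normalForm-sat _ ψ (2c<M ψ≤K) τ ⟨
      (∃[ σ ] SatCNF [ τ , σ ] ψ)     ≈⟨ enc τ ⟨
      evalMon τ (graphFormula s b)    ≈⟨ graphFormula-trueOutside s b p ⟩
      T (not (lookup b p))            ∎
      where
      open import Relation.Binary.Reasoning.Setoid (⇔-setoid 0ℓ)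
      τ = trueOutside (pair s p)
    bit : ∀ p → not (does (satisfiable? (trueOutside (pair s p)) S)) ≡ lookup b p
    bit p = begin
      not (does (satisfiable? τ S))
        ≡⟨ cong not (det (proof (satisfiable? τ S)) (fromEquivalence from to)) ⟩
      not (not (lookup b p))          ≡⟨ not-involutive (lookup b p) ⟩
      lookup b p                      ∎
      where
      open ≡-Reasoning
      open Equivalence (satisfiable⇔ p)
      τ = trueOutside (pair s p)

hardGraphFormula : ∀ s K →
  length (subsetsOfSize≤ (ClauseCodes.#codes (suc s) (suc (2 * K))) K) < 2 ^ pairs s →
  ∃[ b ] ∀ m (ψ : TwoCNF (Fin (suc s) ⊎ Fin m)) → Encodes m ψ (graphFormula s b) → K < length ψ
hardGraphFormula s K few =
  let b , b∉ = bitVector-pigeonhole (pairs s) (map (decodeGraph s K) codeSets) fewDecodings in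
  b , λ m ψ enc → ≰⇒> λ ψ≤K →
    b∉ (subst (_∈ _) (decodeGraph-encodingCode s K b ψ ψ≤K enc)
              (∈-map⁺ (decodeGraph s K) (∈-subsetsOfSize≤ K _ (∣encodingCode∣≤K s K ψ ψ≤K))))
  where
  codeSets = subsetsOfSize≤ (ClauseCodes.#codes (suc s) (suc (2 * K))) K
  fewDecodings : length (map (decodeGraph s K) codeSets) < 2 ^ pairs s
  fewDecodings = subst (_< 2 ^ pairs s) (sym (length-map _ codeSets)) few

n<2^n : ∀ n → n < 2 ^ n
n<2^n zero = s≤s z≤n
n<2^n (suc n) = begin-strict
  suc n            ≤⟨ n<2^n n ⟩
  2 ^ n            <⟨ m<m+n (2 ^ n) (≤-trans (m^n>0 2 n) (m≤m+n (2 ^ n) 0)) ⟩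
  2 ^ n + (2 ^ n + 0) ∎
  where open ≤-Reasoning

2^-cancel-< : ∀ {m n} → 2 ^ m < 2 ^ n → m < n
2^-cancel-< {m} {n} 2^m<2^n with n ≤? m
... | yes n≤m = contradiction (^-monoʳ-≤ 2 n≤m) (<⇒≱ 2^m<2^n)
... | no n≰m = ≰⇒> n≰m

2^-cancel-≤ : ∀ {m n} → 2 ^ m ≤ 2 ^ n → m ≤ n
2^-cancel-≤ {m} {n} 2^m≤2^n =
  s≤s⁻¹ (2^-cancel-< (≤-<-trans 2^m≤2^n (^-monoʳ-< 2 (s≤s (s≤s z≤n)) (n<1+n n))))

log₂-bounds : ∀ n → 0 < n → ∃[ L ] 2 ^ L ≤ n × n < 2 ^ suc L
log₂-bounds (suc zero) _ = 0 , ≤-refl , s≤s (s≤s z≤n)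
log₂-bounds (suc (suc n)) _ with log₂-bounds (suc n) (s≤s z≤n)
... | L , 2^L≤n , n<2^[1+L] with suc (suc n) <? 2 ^ suc L
...   | yes fits = L , m≤n⇒m≤1+n 2^L≤n , fits
...   | no ¬fits = suc L , ≮⇒≥ ¬fits , ≤-<-trans n<2^[1+L] (^-monoʳ-< 2 (s≤s (s≤s z≤n)) (n<1+n (suc L)))

2^m≤n<2^[1+L]⇒m≤L : ∀ {c n L} → 2 ^ c ≤ n → n < 2 ^ suc L → c ≤ L
2^m≤n<2^[1+L]⇒m≤L 2^c≤n n<2^[1+L] = s≤s⁻¹ (2^-cancel-< (≤-<-trans 2^c≤n n<2^[1+L]))

linear≤2^ : ∀ a b → ∃[ x₀ ] ∀ x → x₀ ≤ x → a + b * x ≤ 2 ^ x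
linear≤2^ a b = x₀ , λ x x₀≤x → subst (λ x → a + b * x ≤ 2 ^ x) (m+[n∸m]≡n x₀≤x) (beyond (x ∸ x₀))
  where
  y = suc (a + 2 * b)
  x₀ = 2 * y
  base : a + b * x₀ ≤ 2 ^ x₀
  base = begin
    a + b * (2 * y)              ≤⟨ +-monoˡ-≤ (b * (2 * y)) (m≤n*m a y) ⟩
    y * a + b * (2 * y)          ≤⟨ m≤n+m _ y ⟩
    y + (y * a + b * (2 * y))    ≡⟨ factor y a b ⟩
    y * y                        ≤⟨ *-mono-≤ (<⇒≤ (n<2^n y)) (<⇒≤ (n<2^n y)) ⟩
    2 ^ y * 2 ^ y                ≡⟨ ^-distribˡ-+-* 2 y y ⟨
    2 ^ (y + y)                  ≡⟨ cong (λ e → 2 ^ (y + e)) (+-identityʳ y) ⟨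
    2 ^ x₀                       ∎
    where
    open ≤-Reasoning
    factor : ∀ y a b → y + (y * a + b * (2 * y)) ≡ y * suc (a + 2 * b)
    factor = solve-∀
  beyond : ∀ d → a + b * (x₀ + d) ≤ 2 ^ (x₀ + d)
  beyond zero = subst (λ x → a + b * x ≤ 2 ^ x) (sym (+-identityʳ x₀)) base
  beyond (suc d) = begin
    a + b * (x₀ + suc d)                  ≡⟨ shift a b x₀ d ⟩
    (a + b * (x₀ + d)) + b                ≤⟨ +-mono-≤ (beyond d) b≤2^[x₀+d] ⟩
    2 ^ (x₀ + d) + 2 ^ (x₀ + d)           ≡⟨ cong (2 ^ (x₀ + d) +_) (+-identityʳ _) ⟨
    2 ^ suc (x₀ + d)                      ≡⟨ cong (2 ^_) (+-suc x₀ d) ⟨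
    2 ^ (x₀ + suc d)                      ∎
    where
    open ≤-Reasoning
    shift : ∀ a b x d → a + b * (x + suc d) ≡ (a + b * (x + d)) + b
    shift = solve-∀
    b≤2^[x₀+d] : b ≤ 2 ^ (x₀ + d)
    b≤2^[x₀+d] = ≤-trans (m≤m*n b (x₀ + d)) (≤-trans (m≤n+m _ a) (beyond d))

[4j+2][1+s]²<8k*pairs : ∀ j s → 4 * (4 + j) ≤ s → (4 * j + 2) * (suc s * suc s) < 8 * (4 + j) * pairs s
[4j+2][1+s]²<8k*pairs j s 4k≤s with s ∸ 4 * (4 + j) | m+[n∸m]≡n 4k≤s
... | e | refl = begin-strict
  Z                          <⟨ m<m+n Z (s≤s z≤n) ⟩
  Z + slack                  ≡⟨ +-cancelʳ-≡ (k4 * s) _ _ (begin-equality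
    (Z + slack) + k4 * s       ≡⟨ expand j e ⟨
    k4 * (s * s)               ≡⟨ cong (k4 *_) (2*pairs+s≡s*s s) ⟨
    k4 * (2 * pairs s + s)     ≡⟨ *-distribˡ-+ k4 (2 * pairs s) s ⟩
    k4 * (2 * pairs s) + k4 * s ≡⟨ cong (_+ k4 * s) (regroup j (pairs s)) ⟩
    8 * (4 + j) * pairs s + k4 * s ∎) ⟩
  8 * (4 + j) * pairs s      ∎
  where
  open ≤-Reasoning
  k4 = 4 * (4 + j)
  Z = (4 * j + 2) * (suc s * suc s)
  -- The difference 4k s² − 4k s − Z, expanded at s = 4k + e.
  slack = s * (202 + 40 * j + 14 * e) + (2 + 4 * j) * (15 + 4 * j + e)
  expand : ∀ j e → 4 * (4 + j) * ((4 * (4 + j) + e) * (4 * (4 + j) + e)) ≡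
    ((4 * j + 2) * (suc (4 * (4 + j) + e) * suc (4 * (4 + j) + e))
      + ((4 * (4 + j) + e) * (202 + 40 * j + 14 * e) + (2 + 4 * j) * (15 + 4 * j + e)))
      + 4 * (4 + j) * (4 * (4 + j) + e)
  expand = solve-∀
  regroup : ∀ j p → 4 * (4 + j) * (2 * p) ≡ 8 * (4 + j) * p
  regroup = solve-∀

#codes+K≤2^[4L+11] : ∀ s K L → suc s < 2 ^ suc L → K ≤ suc s * suc s →
  ClauseCodes.#codes (suc s) (suc (2 * K)) + K ≤ 2 ^ (4 * L + 11)
#codes+K≤2^[4L+11] s K L n<2^[1+L] K≤Q = begin
  W * W + K                              ≤⟨ +-mono-≤ (*-mono-≤ W≤8Q W≤8Q) (≤-trans K≤Q (m≤m*n Q Q)) ⟩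
  (8 * Q) * (8 * Q) + Q * Q              ≤⟨ ≤-reflexive (sixtyFive Q) ⟩
  65 * (Q * Q)                           ≤⟨ *-monoˡ-≤ (Q * Q) (m≤m+n 65 63) ⟩
  128 * (Q * Q)                          ≤⟨ *-monoʳ-≤ 128 (*-mono-≤ Q≤4x² Q≤4x²) ⟩
  128 * ((4 * (x * x)) * (4 * (x * x)))  ≡⟨ power x ⟩
  x ^ 4 * 2048                           ≡⟨ cong (_* 2048) (^-*-assoc 2 L 4) ⟩
  2 ^ (L * 4) * 2048                     ≡⟨ cong (λ e → 2 ^ e * 2048) (*-comm L 4) ⟩
  2 ^ (4 * L) * 2048                     ≡⟨ ^-distribˡ-+-* 2 (4 * L) 11 ⟨
  2 ^ (4 * L + 11)                       ∎
  where
  open ≤-Reasoning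
  n = suc s
  Q = n * n
  x = 2 ^ L
  W = n + suc (2 * K) + (n + suc (2 * K))
  W≤8Q : W ≤ 8 * Q
  W≤8Q = ≤-trans (+-mono-≤ V≤4Q V≤4Q) (≤-reflexive (double Q))
    where
    V≤4Q : n + suc (2 * K) ≤ 4 * Q
    V≤4Q = ≤-trans (+-mono-≤ (m≤m*n n n) (+-mono-≤ {1} (s≤s z≤n) (*-monoʳ-≤ 2 K≤Q)))
                   (≤-reflexive (collect Q))
      where
      collect : ∀ Q → Q + (Q + 2 * Q) ≡ 4 * Q
      collect = solve-∀
    double : ∀ Q → 4 * Q + 4 * Q ≡ 8 * Q
    double = solve-∀
  Q≤4x² : Q ≤ 4 * (x * x)
  Q≤4x² = ≤-trans (*-mono-≤ n≤2x n≤2x) (≤-reflexive (square x))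
    where
    n≤2x : n ≤ 2 * x
    n≤2x = <⇒≤ n<2^[1+L]
    square : ∀ x → 2 * x * (2 * x) ≡ 4 * (x * x)
    square = solve-∀
  sixtyFive : ∀ Q → (8 * Q) * (8 * Q) + Q * Q ≡ 65 * (Q * Q)
  sixtyFive = solve-∀
  power : ∀ x → 128 * ((4 * (x * x)) * (4 * (x * x))) ≡ x * (x * (x * (x * 1))) * 2048
  power = solve-∀

m<[1+m/n]*n : ∀ m n .{{_ : NonZero n}} → m < suc (m / n) * n
m<[1+m/n]*n m n = begin-strict
  m                    ≡⟨ m≡m%n+[m/n]*n m n ⟩
  m % n + (m / n) * n  <⟨ +-monoˡ-< _ (m%n<n m n) ⟩
  n + (m / n) * n      ∎
  where open ≤-Reasoning

-- For k = 4 + j and n = s + 1: L = ⌊lg n⌋, D = lg L + O(k), K = ⌊j n² / (4kL)⌋.  With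
-- e = 2L − D, the estimates K! ≥ (2 ^ e) ^ (K − 2 ^ e) and U + K ≤ 2 ^ (4L + 11) bound the
-- number of code sets of size at most K by 2 ^ ((4L + 11) K − e (K − 2 ^ e)), and the
-- constraints below make this exponent smaller than pairs s.
record Parameters (j s : ℕ) : Set where
  field
    L D K           : ℕ
    2^L≤n           : 2 ^ L ≤ suc s
    n<2^[1+L]       : suc s < 2 ^ suc L
    16kL≤2^D        : 16 * (4 + j) * L ≤ 2 ^ D
    2k[11+D]≤L      : 2 * (4 + j) * (11 + D) ≤ L
    4k≤s            : 4 * (4 + j) ≤ s
    K*4kL≤jn²       : K * (4 * (4 + j) * L) ≤ j * (suc s * suc s)
    jn²<[1+K]*4kL   : j * (suc s * suc s) < suc K * (4 * (4 + j) * L)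

module _ {j s : ℕ} (params : Parameters j s) where

  open Parameters params

  private
    k = 4 + j
    n = suc s
    Q = n * n
    e = 2 * L ∸ D
    t = 2 ^ e
    smallCodes = subsetsOfSize≤ (ClauseCodes.#codes n (suc (2 * K))) K

    L>0 : 0 < L
    L>0 = ≤-trans (s≤s z≤n) 2k[11+D]≤L

    D≤2L : D ≤ 2 * L
    D≤2L = ≤-trans (m≤n+m D 11) (≤-trans (m≤n*m (11 + D) (2 * k)) (≤-trans 2k[11+D]≤L (m≤n*m L 2)))

    K≤Q : K ≤ Q
    K≤Q = *-cancelʳ-≤ K Q (4 * k * L) {{>-nonZero (*-mono-≤ {1} {4 * k} (s≤s z≤n) L>0)}}
      (≤-trans K*4kL≤jn² (≤-trans (*-monoˡ-≤ Q j≤4kL) (≤-reflexive (*-comm (4 * k * L) Q))))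
      where
      j≤4kL : j ≤ 4 * k * L
      j≤4kL = ≤-trans (m≤n+m j 4) (≤-trans (m≤n*m k 4) (m≤m*n (4 * k) L {{>-nonZero L>0}}))

    4LK≤Q : 4 * (L * K) ≤ Q
    4LK≤Q = *-cancelˡ-≤ k (≤-trans (≤-reflexive (regroup j L K))
                                   (≤-trans K*4kL≤jn² (*-monoˡ-≤ Q (m≤n+m j 4))))
      where
      regroup : ∀ j L K → (4 + j) * (4 * (L * K)) ≡ K * (4 * (4 + j) * L)
      regroup = solve-∀

    e+D≡2L : e + D ≡ 2 * L
    e+D≡2L = m∸n+n≡m D≤2L

    8ket≤Q : 8 * k * e * t ≤ Q
    8ket≤Q = begin
      8 * k * e * t       ≤⟨ *-monoˡ-≤ t (*-monoʳ-≤ (8 * k) (m∸n≤m (2 * L) D)) ⟩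
      8 * k * (2 * L) * t ≡⟨ cong (_* t) (regroup k L) ⟩
      16 * k * L * t      ≤⟨ *-monoˡ-≤ t 16kL≤2^D ⟩
      2 ^ D * 2 ^ e       ≡⟨ ^-distribˡ-+-* 2 D e ⟨
      2 ^ (D + e)         ≡⟨ cong (2 ^_) (trans (+-comm D e) e+D≡2L) ⟩
      2 ^ (2 * L)         ≡⟨ cong (2 ^_) (cong (L +_) (+-identityʳ L)) ⟩
      2 ^ (L + L)         ≡⟨ ^-distribˡ-+-* 2 L L ⟩
      2 ^ L * 2 ^ L       ≤⟨ *-mono-≤ 2^L≤n 2^L≤n ⟩
      Q                   ∎
      where
      open ≤-Reasoning
      regroup : ∀ k L → 8 * k * (2 * L) ≡ 16 * k * L
      regroup = solve-∀

    X+et<pairs : (2 * L + 11 + D) * K + e * t < pairs s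
    X+et<pairs = *-cancelˡ-< (8 * k) _ _ (begin-strict
      8 * k * ((2 * L + 11 + D) * K + e * t)
        ≡⟨ expand k L D K e t ⟩
      4 * (K * (4 * k * L)) + 4 * (2 * k * (11 + D) * K) + 8 * k * e * t
        ≤⟨ +-mono-≤ (+-mono-≤ (*-monoʳ-≤ 4 K*4kL≤jn²)
                              (≤-trans (*-monoʳ-≤ 4 (*-monoˡ-≤ K 2k[11+D]≤L)) 4LK≤Q))
                    8ket≤Q ⟩
      4 * (j * Q) + Q + Q
        ≡⟨ collect j Q ⟩
      (4 * j + 2) * Q
        <⟨ [4j+2][1+s]²<8k*pairs j s 4k≤s ⟩
      8 * k * pairs s ∎)
      where
      open ≤-Reasoning
      expand : ∀ k L D K e t → 8 * k * ((2 * L + 11 + D) * K + e * t) ≡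
        4 * (K * (4 * k * L)) + 4 * (2 * k * (11 + D) * K) + 8 * k * e * t
      expand = solve-∀
      collect : ∀ j Q → 4 * (j * Q) + Q + Q ≡ (4 * j + 2) * Q
      collect = solve-∀

    exponent< : (4 * L + 11) * K < pairs s + e * (K ∸ t)
    exponent< = begin-strict
      (4 * L + 11) * K                       ≡⟨ cong (_* K) (split L) ⟩
      (2 * L + 11 + 2 * L) * K               ≡⟨ cong (λ z → (2 * L + 11 + z) * K) e+D≡2L ⟨
      (2 * L + 11 + (e + D)) * K             ≡⟨ regroup L D K e ⟩
      e * K + (2 * L + 11 + D) * K           ≤⟨ +-monoˡ-≤ _ (*-monoʳ-≤ e (m≤n+m∸n K t)) ⟩
      e * (t + (K ∸ t)) + (2 * L + 11 + D) * K ≡⟨ reorder e t (K ∸ t) ((2 * L + 11 + D) * K) ⟩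
      ((2 * L + 11 + D) * K + e * t) + e * (K ∸ t) <⟨ +-monoˡ-< _ X+et<pairs ⟩
      pairs s + e * (K ∸ t)                  ∎
      where
      open ≤-Reasoning
      split : ∀ L → 4 * L + 11 ≡ 2 * L + 11 + 2 * L
      split = solve-∀
      regroup : ∀ L D K e → (2 * L + 11 + (e + D)) * K ≡ e * K + (2 * L + 11 + D) * K
      regroup = solve-∀
      reorder : ∀ e t r X → e * (t + r) + X ≡ (X + e * t) + e * r
      reorder = solve-∀

  fewCodeSets : length (subsetsOfSize≤ (ClauseCodes.#codes (suc s) (suc (2 * K))) K) < 2 ^ pairs s
  fewCodeSets with length smallCodes <? 2 ^ pairs s
  ... | yes few = few
  ... | no many = contradiction (2^-cancel-≤ (begin
    2 ^ (pairs s + e * (K ∸ t))                ≡⟨ ^-distribˡ-+-* 2 (pairs s) _ ⟩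
    2 ^ pairs s * 2 ^ (e * (K ∸ t))            ≤⟨ *-mono-≤ (≮⇒≥ many) (≤-reflexive (sym (^-*-assoc 2 e _))) ⟩
    length smallCodes * t ^ (K ∸ t)            ≤⟨ *-monoʳ-≤ (length smallCodes) (m^[n∸m]≤n! t K) ⟩
    length smallCodes * K !                    ≤⟨ length-subsetsOfSize≤-bound _ K ⟩
    (ClauseCodes.#codes n (suc (2 * K)) + K) ^ K
                                               ≤⟨ ^-monoˡ-≤ K (#codes+K≤2^[4L+11] s K L n<2^[1+L] K≤Q) ⟩
    (2 ^ (4 * L + 11)) ^ K                     ≡⟨ ^-*-assoc 2 (4 * L + 11) K ⟩
    2 ^ ((4 * L + 11) * K)                     ∎))
    (<⇒≱ exponent<)
    where open ≤-Reasoning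

  boundHolds : ∀ {c} → K < c → BoundHolds (4 + j) (suc s) c
  boundHolds {c} K<c = begin
    2 ^ (j * Q)             ≤⟨ ^-monoʳ-≤ 2 (<⇒≤ jQ<L*4kc) ⟩
    2 ^ (L * (4 * k * c))   ≡⟨ ^-*-assoc 2 L (4 * k * c) ⟨
    (2 ^ L) ^ (4 * k * c)   ≤⟨ ^-monoˡ-≤ (4 * k * c) 2^L≤n ⟩
    n ^ (4 * k * c)         ∎
    where
    open ≤-Reasoning
    jQ<L*4kc : j * Q < L * (4 * k * c)
    jQ<L*4kc = <-≤-trans jn²<[1+K]*4kL
      (≤-trans (*-monoˡ-≤ (4 * k * L) K<c) (≤-reflexive (regroup c k L)))
      where
      regroup : ∀ c k L → c * (4 * k * L) ≡ L * (4 * k * c)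
      regroup = solve-∀

mkParameters : ∀ j s L L₂ → 2 ^ L ≤ suc s → suc s < 2 ^ suc L → L < 2 ^ suc L₂ →
  2 * (4 + j) * (16 + (4 + j)) + 2 * (4 + j) * L₂ ≤ L → 4 * (4 + j) ≤ s → Parameters j s
mkParameters j s L L₂ 2^L≤n n<2^[1+L] L<2^[1+L₂] linear≤L 4k≤s = record
  { L = L ; D = D ; K = K
  ; 2^L≤n = 2^L≤n
  ; n<2^[1+L] = n<2^[1+L]
  ; 16kL≤2^D = 16kL≤2^D
  ; 2k[11+D]≤L = ≤-trans (≤-reflexive (expand k L₂)) linear≤L
  ; 4k≤s = 4k≤s
  ; K*4kL≤jn² = m/n*n≤m (j * (suc s * suc s)) (4 * k * L)
  ; jn²<[1+K]*4kL = m<[1+m/n]*n (j * (suc s * suc s)) (4 * k * L)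
  }
  where
  k = 4 + j
  D = 5 + k + L₂
  instance
    4kL≢0 : NonZero (4 * k * L)
    4kL≢0 = >-nonZero (*-mono-≤ {1} {4 * k} (s≤s z≤n) (≤-trans (s≤s z≤n) linear≤L))
  K = j * (suc s * suc s) / (4 * k * L)
  expand : ∀ k L₂ → 2 * k * (11 + (5 + k + L₂)) ≡ 2 * k * (16 + k) + 2 * k * L₂
  expand = solve-∀
  16kL≤2^D : 16 * k * L ≤ 2 ^ D
  16kL≤2^D = begin
    16 * k * L                   ≤⟨ *-mono-≤ (*-monoʳ-≤ 16 (<⇒≤ (n<2^n k))) (<⇒≤ L<2^[1+L₂]) ⟩
    16 * 2 ^ k * 2 ^ suc L₂      ≡⟨ cong (_* 2 ^ suc L₂) (^-distribˡ-+-* 2 4 k) ⟨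
    2 ^ (4 + k) * 2 ^ suc L₂     ≡⟨ ^-distribˡ-+-* 2 (4 + k) (suc L₂) ⟨
    2 ^ (4 + k + suc L₂)         ≡⟨ cong (2 ^_) (+-suc (4 + k) L₂) ⟩
    2 ^ D                        ∎
    where open ≤-Reasoning

parametersBeyond : ∀ j x₀ →
  (∀ x → x₀ ≤ x → 2 * (4 + j) * (16 + (4 + j)) + 2 * (4 + j) * x ≤ 2 ^ x) →
  ∀ s → 2 ^ (2 ^ x₀) + 4 * (4 + j) ≤ s → Parameters j s
parametersBeyond j x₀ linear≤2^x s N≤s with log₂-bounds (suc s) (s≤s z≤n)
... | L , 2^L≤n , n<2^[1+L]
  with 2^m≤n<2^[1+L]⇒m≤L (≤-trans (m≤m+n (2 ^ (2 ^ x₀)) (4 * (4 + j))) (m≤n⇒m≤1+n N≤s)) n<2^[1+L]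
... | 2^x₀≤L with log₂-bounds L (≤-trans (m^n>0 2 x₀) 2^x₀≤L)
... | L₂ , 2^L₂≤L , L<2^[1+L₂] =
  mkParameters j s L L₂ 2^L≤n n<2^[1+L] L<2^[1+L₂]
    (≤-trans (linear≤2^x L₂ (2^m≤n<2^[1+L]⇒m≤L 2^x₀≤L L<2^[1+L₂])) 2^L₂≤L)
    (≤-trans (m≤n+m (4 * (4 + j)) (2 ^ (2 ^ x₀))) N≤s)

parameters : ∀ j → ∃[ N ] ∀ s → N ≤ s → Parameters j s
parameters j =
  let x₀ , linear≤2^x = linear≤2^ (2 * (4 + j) * (16 + (4 + j))) (2 * (4 + j))
  in 2 ^ (2 ^ x₀) + 4 * (4 + j) , parametersBeyond j x₀ linear≤2^x

HardFormulasFor : ℕ → Set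
HardFormulasFor k = ∃[ N ] ((n : ℕ) → N ≤ n →
  ∃[ φ ] (HasAllVars {n} φ × SmallestEncodingAtLeast φ (BoundHolds k n)))

hardFormulasFor-4+j : ∀ j → HardFormulasFor (4 + j)
hardFormulasFor-4+j j = let N , params = parameters j in suc N , λ where
  zero ()
  (suc s) N<1+s → let p = params s (s≤s⁻¹ N<1+s)
                      b , hard = hardGraphFormula s (Parameters.K p) (fewCodeSets p) in
    graphFormula s b ,
    graphFormula-hasAllVars s b (≤-trans (s≤s z≤n) (Parameters.4k≤s p)) ,
    λ m ψ enc → boundHolds p (hard m ψ enc)

-- For k ≤ 4 the bound reads 1 ≤ n ^ (4 k c), so proposition25 does not need 1 ≤ k.
hardFormulasFor-≤4 : ∀ {k} → k ≤ 4 → HardFormulasFor k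
hardFormulasFor-≤4 {k} k≤4 = 2 , λ where
  (suc s) (s≤s 0<s) → let b = replicate (pairs s) false in
    graphFormula s b , graphFormula-hasAllVars s b 0<s ,
    λ m ψ _ → subst (λ z → 2 ^ (z * (suc s * suc s)) ≤ suc s ^ (4 * k * length ψ))
                    (sym (m≤n⇒m∸n≡0 k≤4)) (m^n>0 (suc s) (4 * k * length ψ))

proposition25 : (k : ℕ) → 1 ≤ k →
    ∃[ N ] ((n : ℕ) → N ≤ n →
      ∃[ φ ] (HasAllVars {n} φ ×
        SmallestEncodingAtLeast φ (BoundHolds k n)))
proposition25 k _ with k ≤? 4
... | yes k≤4 = hardFormulasFor-≤4 k≤4
... | no k≰4 with k ∸ 4 | m+[n∸m]≡n (<⇒≤ (≰⇒> k≰4))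
...   | j | refl = hardFormulasFor-4+j j
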